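{- Assume $p\ge11$. Let $a,b,\theta,v_0\in S$ with $\Delta(a,b),H(a,b),b\in S^\times$. Put $\lambda_0=H(a,b)^{ -1}$, $f(x)=x^3+ax+b$, and let $c_s,d_s,e_s,f_s$ be the coefficients of $x^{sp-1}$ in $C(x)=\frac{\lambda_0}{2}f^{\frac{p-1}{2}}(3x^{2p}+a^p)x^p\theta$, $D(x)=\frac{\lambda_0}{2}f^{\frac{p-1}{2}}(K_0(x)+(3x^{2p}+a^p)W_0(x))$, $E(x)=\frac{\lambda_0}{2}f^{\frac{p-1}{2}}\delta b$, $F(x)=\frac{\lambda_0}{2}f^{\frac{p-1}{2}}x^p\delta a$, where $K_0(x)=\frac1p(x^{3p}+a^px^p+b^p-f(x)^p)$ and $W_0'=\lambda_0f^{\frac{p-1}{2}}-x^{p-1}$, $W_0(0)=0$. Consider the congruences (with $v_{ -1}=v_{ -2}=0$) $$(\ast)_s:\quad sb^pv_s\equiv\Big(\tfrac32-s\Big)a^pv_{s-1}+\Big(\tfrac92-s\Big)v_{s-3}+c_s+d_s+e_s+f_s\pmod p.$$ Let $v_1,\dots,v_{\frac{p+7}{2}}\in S$ be such that $(\ast)_s$ holds for $1\le s\le\frac{p+7}{2}$ (such $v_s$ exist and are unique mod $p$ given $v_0$). If $v_{\frac{p+5}{2}}\equiv v_{\frac{p+7}{2}}\equiv0\pmod p$, then the sequence $v_0,v_1,\dots,v_{\frac{p+3}{2}},0,0,\dots$ satisfies $(\ast)_s$ for all $s\ge1$.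
   Context: $p$ is a prime, $p\neq2,3$. $S$ is a $p$-torsion free $p$-adically complete ring with a Frobenius lift $\phi^S$ (ring endomorphism reducing mod $p$ to the $p$-power map), and $\delta u:=(\phi^S(u)-u^p)/p$. $\Delta(z_4,z_6)=4z_4^3+27z_6^2$; $H(z_4,z_6)$ is the coefficient of $x^{p-1}$ in $(x^3+z_4x+z_6)^{(p-1)/2}$. -}

module Defs where

open import Level using (_⊔_)
open import Algebra.Bundles using (CommutativeRing)
open import Data.Nat as ℕ using (ℕ; zero; suc; _∸_; _≡ᵇ_; _≤ᵇ_)
open import Data.Bool using (if_then_else_)
open import Data.Product using (∃; _×_)

bound3 bound5 bound7 : ℕ → ℕ
bound3 p = (p ℕ.+ 3) ℕ./ 2
bound5 p = (p ℕ.+ 5) ℕ./ 2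
bound7 p = (p ℕ.+ 7) ℕ./ 2

module WithRing {c ℓ} (R : CommutativeRing c ℓ) where
  open CommutativeRing R

  ι : ℕ → Carrier
  ι zero = 0#
  ι (suc n) = 1# + ι n

  infixr 8 _^_
  _^_ : Carrier → ℕ → Carrier
  x ^ zero = 1#
  x ^ suc n = x * (x ^ n)

  infixl 6 _−_
  _−_ : Carrier → Carrier → Carrier
  x − y = x + (- y)

  _∣ₛ_ : Carrier → Carrier → Set (c ⊔ ℓ)
  d ∣ₛ x = ∃ λ z → x ≈ d * z

  _≡_[mod_] : Carrier → Carrier → Carrier → Set (c ⊔ ℓ)
  x ≡ y [mod m ] = m ∣ₛ (x − y)

  IsUnit : Carrier → Set (c ⊔ ℓ)
  IsUnit x = ∃ λ u → x * u ≈ 1#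

  TorsionFree : ℕ → Set (c ⊔ ℓ)
  TorsionFree p = ∀ x → ι p * x ≈ 0# → x ≈ 0#

  -- S is p-adically separated and complete (S → lim S/p^n is bijective)
  PAdicComplete : ℕ → Set (c ⊔ ℓ)
  PAdicComplete p =
    (∀ x → (∀ n → (ι p ^ n) ∣ₛ x) → x ≈ 0#) ×
    (∀ (x : ℕ → Carrier) → (∀ n → (ι p ^ n) ∣ₛ (x (suc n) − x n)) →
       ∃ λ y → ∀ n → (ι p ^ n) ∣ₛ (y − x n))

  IsFrobeniusLift : ℕ → (Carrier → Carrier) → Set (c ⊔ ℓ)
  IsFrobeniusLift p φ =
    (∀ {x y} → x ≈ y → φ x ≈ φ y) ×
    (∀ x y → φ (x + y) ≈ φ x + φ y) ×
    (∀ x y → φ (x * y) ≈ φ x * φ y) ×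
    (φ 1# ≈ 1#) ×
    (∀ x → (ι p) ∣ₛ (φ x − x ^ p))

  -- Polynomials / formal power series over S, as coefficient sequences
  Poly : Set c
  Poly = ℕ → Carrier

  sumUpTo : ℕ → (ℕ → Carrier) → Carrier
  sumUpTo zero g = g 0
  sumUpTo (suc n) g = sumUpTo n g + g (suc n)

  mono : Carrier → ℕ → Poly
  mono a k n = if k ≡ᵇ n then a else 0#

  infixl 6 _⊕_ _⊖_
  infixl 7 _⊗_ _·_
  _⊕_ _⊖_ _⊗_ : Poly → Poly → Poly
  (f ⊕ g) n = f n + g n
  (f ⊖ g) n = f n − g n
  (f ⊗ g) n = sumUpTo n (λ i → f i * g (n ∸ i))

  _·_ : Carrier → Poly → Poly
  (a · f) n = a * f n

  powP : Poly → ℕ → Poly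
  powP f zero = mono 1# 0
  powP f (suc n) = f ⊗ powP f n

  deriv : Poly → Poly
  deriv f n = ι (suc n) * f (suc n)

  cubic : Carrier → Carrier → Poly
  cubic z4 z6 = mono 1# 3 ⊕ mono z4 1 ⊕ mono z6 0

  Δ : Carrier → Carrier → Carrier
  Δ z4 z6 = ι 4 * z4 ^ 3 + ι 27 * z6 ^ 2

  H : ℕ → Carrier → Carrier → Carrier
  H p z4 z6 = powP (cubic z4 z6) ((p ∸ 1) ℕ./ 2) (p ∸ 1)

  fHalf : ℕ → Carrier → Carrier → Poly
  fHalf p a b = powP (cubic a b) ((p ∸ 1) ℕ./ 2)

  -- K0 = (1/p)(x^{3p} + a^p x^p + b^p - f(x)^p)   (division by p characterised
  -- by p·K0 = ..., which determines K0 uniquely as S is p-torsion free)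
  IsK0 : ℕ → Carrier → Carrier → Poly → Set ℓ
  IsK0 p a b K0 = ∀ n →
    ι p * K0 n ≈ (mono 1# (3 ℕ.* p) ⊕ mono (a ^ p) p ⊕ mono (b ^ p) 0 ⊖ powP (cubic a b) p) n

  IsW0 : ℕ → Carrier → Carrier → Carrier → Poly → Set ℓ
  IsW0 p a b λ0 W0 =
    (W0 0 ≈ 0#) × (∀ n → deriv W0 n ≈ (λ0 · fHalf p a b ⊖ mono 1# (p ∸ 1)) n)

  module Setup (p : ℕ) (a b θ λ0 half δa δb : Carrier) (K0 W0 : Poly) where
    pre : Poly
    pre = (λ0 * half) · fHalf p a b

    T : Poly
    T = ι 3 · mono 1# (2 ℕ.* p) ⊕ mono (a ^ p) 0

    Cp Dp Ep Fp : Poly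
    Cp = pre ⊗ T ⊗ mono θ p
    Dp = pre ⊗ (K0 ⊕ T ⊗ W0)
    Ep = pre ⊗ mono δb 0
    Fp = pre ⊗ mono δa p

    cc dd ee ff : ℕ → Carrier
    cc s = Cp (s ℕ.* p ∸ 1)
    dd s = Dp (s ℕ.* p ∸ 1)
    ee s = Ep (s ℕ.* p ∸ 1)
    ff s = Fp (s ℕ.* p ∸ 1)

    back : ℕ → (ℕ → Carrier) → ℕ → Carrier
    back k v s = if k ≤ᵇ s then v (s ∸ k) else 0#

    Star : (ℕ → Carrier) → ℕ → Set (c ⊔ ℓ)
    Star v s =
      (ι s * b ^ p * v s)
        ≡ (ι 3 * half − ι s) * a ^ p * back 1 v s
          + (ι 9 * half − ι s) * back 3 v s
          + cc s + dd s + ee s + ff s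
        [mod ι p ]

  truncate : ℕ → (ℕ → Carrier) → ℕ → Carrier
  truncate N v s = if s ≤ᵇ N then v s else 0#

module Submission where

-- Write p = 2m + 1 and N = (p+3)/2 = m + 2, and let w be v truncated after
-- index N.  The argument has three ingredients.
--  * For 1 ≤ s ≤ N + 2 the sequences v and w agree modulo p at every index
--    ≤ s (because v_{N+1} ≡ v_{N+2} ≡ 0), and (∗)_s only involves v_s,
--    v_{s-1}, v_{s-3}; so (∗)_s for v gives (∗)_s for w.
--  * For s ≥ N + 3 every term of (∗)_s for w vanishes modulo p: w_s, w_{s-1}
--    are zero; w_{s-3} is zero unless s = N + 3 = (p+9)/2, where its
--    coefficient 9/2 - s = -p/2 is divisible by p; and c_s, d_s, e_s, f_s ≡ 0.
--  * The last point is a degree count: modulo p, the series C, D, E, F are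
--    polynomials of degree ≤ 8p + 1 < sp - 1 once s ≥ 9.  For K0 this uses
--    p-torsion freeness, and for W0 (known only through W0') it uses that
--    j · X = 0 with j > 0 forces X ≡ 0 mod p in a p-torsion-free ring.

open import Defs
open import Level using (_⊔_) renaming (suc to lsuc)
open import Algebra.Bundles using (CommutativeRing)
open import Data.Nat as ℕ using (ℕ; zero; suc; _≤_; _<_; z≤n; s≤s; _≤ᵇ_; _≡ᵇ_)
import Data.Nat.Properties as ℕₚ
open import Data.Nat.DivMod using (_/_; _%_; m%n<n; m≡m%n+[m/n]*n; m*n/n≡m; m/n≤m)
open import Data.Nat.Divisibility using (_∣_; _∣?_; divides; m%n≡0⇒n∣m)
open import Data.Nat.Primality using (Prime; prime⇒irreducible; prime⇒nonTrivial)
open import Data.Nat.Coprimality using (Coprime; coprime-Bézout)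
open import Data.Nat.GCD using (module Bézout)
open import Data.Nat.Induction using (<-wellFounded)
open import Data.Nat.Tactic.RingSolver using (solve-∀)
open import Induction.WellFounded using (Acc; acc)
open import Data.Bool using (true; false)
open import Data.Product using (∃; _×_; _,_; proj₂)
open import Data.Sum using (_⊎_; inj₁; inj₂)
open import Data.Unit using (tt)
open import Data.Empty using (⊥-elim)
open import Relation.Nullary using (¬_; yes; no)
open import Relation.Binary.Bundles using (Setoid)
open import Relation.Binary.PropositionalEquality as Eq using (_≡_; cong; subst)
import Algebra.Solver.Ring.NaturalCoefficients.Default as SemiringSolver

odd-prime : ∀ {p} → Prime p → 3 ≤ p → ∃ λ m → p ≡ suc (m ℕ.* 2)
odd-prime {p} p-prime 3≤p with p % 2 | m%n<n p 2 | m≡m%n+[m/n]*n p 2 | m%n≡0⇒n∣m p 2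
... | 0           | _            | _  | even⇒2∣p = ⊥-elim (2∤p (even⇒2∣p Eq.refl))
  where
  2∤p : ¬ 2 ∣ p
  2∤p 2∣p with prime⇒irreducible p-prime 2∣p
  ... | inj₁ ()
  ... | inj₂ 2≡p = ℕₚ.<⇒≢ 3≤p 2≡p
... | 1           | _            | p≡ | _        = p / 2 , p≡
... | suc (suc _) | s≤s (s≤s ()) | _  | _

-- (2m + 1 + 2k + 1) / 2 = m + k + 1; with k = 1, 2, 3 this computes the
-- bounds (p+3)/2, (p+5)/2, (p+7)/2 for p = 2m + 1.
half-of-odd-sum : ∀ m k → (suc (m ℕ.* 2) ℕ.+ suc (k ℕ.* 2)) / 2 ≡ suc (k ℕ.+ m)
half-of-odd-sum m k = Eq.trans (cong (_/ 2) (sum≡ m k)) (m*n/n≡m (suc (k ℕ.+ m)) 2)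
  where
  sum≡ : ∀ m k → suc (m ℕ.* 2) ℕ.+ suc (k ℕ.* 2) ≡ suc (k ℕ.+ m) ℕ.* 2
  sum≡ = solve-∀

-- The index (p+9)/2 = N + 3, where the coefficient 9/2 - s of (∗)_s vanishes.
centre-index : ∀ m → (5 ℕ.+ m) ℕ.* 2 ≡ suc (m ℕ.* 2) ℕ.+ 9
centre-index = solve-∀

centre-large : ∀ m → 11 ≤ suc (m ℕ.* 2) → 9 ≤ 5 ℕ.+ m
centre-large m 11≤p = ℕₚ.+-monoʳ-≤ 5 (ℕₚ.≤-trans (ℕₚ.n≤1+n 4) 5≤m)
  where
  5≤m : 5 ≤ m
  5≤m = ℕₚ.*-cancelʳ-≤ 5 m 2 (ℕₚ.≤-pred 11≤p)

-- Degree 8p + 1 (the bound for C, D, E, F below) lies below sp - 1 once s ≥ 9.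
below-sp-1 : ∀ {p s} → 3 ≤ p → 9 ≤ s → 3 ℕ.* p ℕ.+ (2 ℕ.* p ℕ.+ suc (3 ℕ.* p)) < s ℕ.* p ℕ.∸ 1
below-sp-1 {p} {s} 3≤p 9≤s = ℕₚ.m+n≤o⇒m≤o∸n _ (begin
  suc (3 ℕ.* p ℕ.+ (2 ℕ.* p ℕ.+ suc (3 ℕ.* p))) ℕ.+ 1 ≡⟨ lhs≡ p ⟩
  8 ℕ.* p ℕ.+ 3                                        ≤⟨ ℕₚ.+-monoʳ-≤ (8 ℕ.* p) 3≤p ⟩
  8 ℕ.* p ℕ.+ p                                        ≡⟨ ℕₚ.+-comm (8 ℕ.* p) p ⟩
  9 ℕ.* p                                              ≤⟨ ℕₚ.*-monoˡ-≤ p 9≤s ⟩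
  s ℕ.* p                                              ∎)
  where
  open ℕₚ.≤-Reasoning
  lhs≡ : ∀ p → suc (3 ℕ.* p ℕ.+ (2 ℕ.* p ℕ.+ suc (3 ℕ.* p))) ℕ.+ 1 ≡ 8 ℕ.* p ℕ.+ 3
  lhs≡ = solve-∀

complement-index : ∀ {i d₁ d₂ n} → i ≤ d₁ → d₁ ℕ.+ d₂ < n → d₂ < n ℕ.∸ i
complement-index {i} {d₁} {d₂} {n} i≤d₁ d₁+d₂<n = ℕₚ.m+n≤o⇒m≤o∸n (suc d₂) (begin
  suc d₂ ℕ.+ i      ≤⟨ ℕₚ.+-monoʳ-≤ (suc d₂) i≤d₁ ⟩
  suc d₂ ℕ.+ d₁     ≡⟨ cong suc (ℕₚ.+-comm d₂ d₁) ⟩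
  suc (d₁ ℕ.+ d₂)   ≤⟨ d₁+d₂<n ⟩
  n                 ∎)
  where open ℕₚ.≤-Reasoning

prime-coprime : ∀ {p j} → Prime p → ¬ p ∣ j → Coprime p j
prime-coprime p-prime p∤j (d∣p , d∣j) with prime⇒irreducible p-prime d∣p
... | inj₁ d≡1    = d≡1
... | inj₂ Eq.refl = ⊥-elim (p∤j d∣j)

cofactor-smaller : ∀ {p q j} → 1 < p → 0 < j → j ≡ q ℕ.* p → 0 < q × q < j
cofactor-smaller {q = zero}  _   0<j Eq.refl = ⊥-elim (ℕₚ.<-irrefl Eq.refl 0<j)
cofactor-smaller {p} {suc q} 1<p _   Eq.refl = s≤s z≤n , ℕₚ.m<m*n (suc q) p 1<p

just-above : ∀ {N t} → N < t → t ≤ 2 ℕ.+ N → t ≡ suc N ⊎ t ≡ 2 ℕ.+ N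
just-above N<t t≤2+N with ℕₚ.m≤n⇒m<n∨m≡n t≤2+N
... | inj₁ t<2+N = inj₁ (ℕₚ.≤-antisym (ℕₚ.≤-pred t<2+N) N<t)
... | inj₂ t≡2+N = inj₂ t≡2+N

shifted-above : ∀ {k N s} → k ℕ.+ N < s → N < s ℕ.∸ k
shifted-above {k} {N} {s} k+N<s =
  ℕₚ.m+n≤o⇒m≤o∸n (suc N) (subst (λ x → suc x ≤ s) (ℕₚ.+-comm k N) k+N<s)

module RingFacts {c ℓ} (R : CommutativeRing c ℓ) where
  open CommutativeRing R
  open WithRing R
  open import Algebra.Properties.Ring ring using (-1*x≈-x; -‿distribʳ-*)
  open import Algebra.Properties.Monoid.Mult +-monoid using (×-homo-+)
  open import Algebra.Properties.Semiring.Mult semiring using (×1-homo-*)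
  open import Algebra.Definitions.RawMonoid +-rawMonoid using () renaming (_×_ to _×₊_)
  open SemiringSolver commutativeSemiring using (solve; _:=_; _:+_; _:*_; con)
  open import Relation.Binary.Reasoning.Setoid setoid

  ι≈×1 : ∀ n → ι n ≈ n ×₊ 1#
  ι≈×1 zero = refl
  ι≈×1 (suc n) = +-congˡ (ι≈×1 n)

  ι-+ : ∀ m n → ι (m ℕ.+ n) ≈ ι m + ι n
  ι-+ m n = begin
    ι (m ℕ.+ n)             ≈⟨ ι≈×1 (m ℕ.+ n) ⟩
    (m ℕ.+ n) ×₊ 1#         ≈⟨ ×-homo-+ 1# m n ⟩
    m ×₊ 1# + n ×₊ 1#       ≈⟨ +-cong (ι≈×1 m) (ι≈×1 n) ⟨
    ι m + ι n               ∎

  ι-* : ∀ m n → ι (m ℕ.* n) ≈ ι m * ι n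
  ι-* m n = begin
    ι (m ℕ.* n)             ≈⟨ ι≈×1 (m ℕ.* n) ⟩
    (m ℕ.* n) ×₊ 1#         ≈⟨ ×1-homo-* m n ⟩
    (m ×₊ 1#) * (n ×₊ 1#)   ≈⟨ *-cong (ι≈×1 m) (ι≈×1 n) ⟨
    ι m * ι n               ∎

  ι-cong : ∀ {m n} → m ≡ n → ι m ≈ ι n
  ι-cong Eq.refl = refl

  -- The shape in which Bézout identities 1 + k n = … enter the ring.
  ι-1+* : ∀ k n X → ι (suc (k ℕ.* n)) * X ≈ X + ι k * (ι n * X)
  ι-1+* k n X = begin
    (1# + ι (k ℕ.* n)) * X     ≈⟨ *-congʳ (+-congˡ (ι-* k n)) ⟩
    (1# + ι k * ι n) * X       ≈⟨ solve 3 (λ k n X → (con 1 :+ k :* n) :* X := X :+ k :* (n :* X)) refl (ι k) (ι n) X ⟩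
    X + ι k * (ι n * X)        ∎

  module Congruence (π : Carrier) where

    from-witness : ∀ {x y} z → x ≈ y + π * z → x ≡ y [mod π ]
    from-witness {x} {y} z x≈ = z , (begin
      x − y                 ≈⟨ +-congʳ x≈ ⟩
      (y + π * z) + - y     ≈⟨ solve 3 (λ y t y′ → (y :+ t) :+ y′ := t :+ (y :+ y′)) refl y (π * z) (- y) ⟩
      π * z + (y − y)       ≈⟨ +-congˡ (-‿inverseʳ y) ⟩
      π * z + 0#            ≈⟨ +-identityʳ (π * z) ⟩
      π * z                 ∎)

    to-witness : ∀ {x y} → x ≡ y [mod π ] → ∃ λ z → x ≈ y + π * z
    to-witness {x} {y} (z , x−y≈) = z , (begin
      x                     ≈⟨ +-identityʳ x ⟨
      x + 0#                ≈⟨ +-congˡ (-‿inverseˡ y) ⟨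
      x + (- y + y)         ≈⟨ solve 3 (λ x y′ y → x :+ (y′ :+ y) := y :+ (x :+ y′)) refl x (- y) y ⟩
      y + (x − y)           ≈⟨ +-congˡ x−y≈ ⟩
      y + π * z             ∎)

    divisible⇒≡0 : ∀ {x} z → x ≈ π * z → x ≡ 0# [mod π ]
    divisible⇒≡0 {x} z x≈πz = from-witness z (trans x≈πz (sym (+-identityˡ (π * z))))

    ≈⇒≡ : ∀ {x y} → x ≈ y → x ≡ y [mod π ]
    ≈⇒≡ {x} {y} x≈y = from-witness 0# (begin
      x                     ≈⟨ x≈y ⟩
      y                     ≈⟨ +-identityʳ y ⟨
      y + 0#                ≈⟨ +-congˡ (zeroʳ π) ⟨
      y + π * 0#            ∎)

    mod-refl : ∀ {x} → x ≡ x [mod π ]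
    mod-refl = ≈⇒≡ refl

    mod-sym : ∀ {x y} → x ≡ y [mod π ] → y ≡ x [mod π ]
    mod-sym {x} {y} x≡y with to-witness x≡y
    ... | z , x≈ = from-witness (- z) (begin
      y                          ≈⟨ +-identityʳ y ⟨
      y + 0#                     ≈⟨ +-congˡ (trans (*-congˡ (-‿inverseʳ z)) (zeroʳ π)) ⟨
      y + π * (z + - z)          ≈⟨ solve 4 (λ y π z z′ → y :+ π :* (z :+ z′) := (y :+ π :* z) :+ π :* z′) refl y π z (- z) ⟩
      (y + π * z) + π * - z      ≈⟨ +-congʳ x≈ ⟨
      x + π * - z                ∎)

    mod-trans : ∀ {x y w} → x ≡ y [mod π ] → y ≡ w [mod π ] → x ≡ w [mod π ]
    mod-trans {x} {y} {w} x≡y y≡w with to-witness x≡y | to-witness y≡w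
    ... | z₁ , x≈ | z₂ , y≈ = from-witness (z₂ + z₁) (begin
      x                          ≈⟨ x≈ ⟩
      y + π * z₁                 ≈⟨ +-congʳ y≈ ⟩
      (w + π * z₂) + π * z₁      ≈⟨ solve 4 (λ w π z₂ z₁ → (w :+ π :* z₂) :+ π :* z₁ := w :+ π :* (z₂ :+ z₁)) refl w π z₂ z₁ ⟩
      w + π * (z₂ + z₁)          ∎)

    +-cong-mod : ∀ {x y u v} → x ≡ y [mod π ] → u ≡ v [mod π ] → (x + u) ≡ y + v [mod π ]
    +-cong-mod {x} {y} {u} {v} x≡y u≡v with to-witness x≡y | to-witness u≡v
    ... | z₁ , x≈ | z₂ , u≈ = from-witness (z₁ + z₂) (begin
      x + u                      ≈⟨ +-cong x≈ u≈ ⟩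
      (y + π * z₁) + (v + π * z₂) ≈⟨ solve 5 (λ y v π z₁ z₂ → (y :+ π :* z₁) :+ (v :+ π :* z₂) := (y :+ v) :+ π :* (z₁ :+ z₂)) refl y v π z₁ z₂ ⟩
      (y + v) + π * (z₁ + z₂)    ∎)

    *-cong-mod : ∀ {x y u v} → x ≡ y [mod π ] → u ≡ v [mod π ] → (x * u) ≡ y * v [mod π ]
    *-cong-mod {x} {y} {u} {v} x≡y u≡v with to-witness x≡y | to-witness u≡v
    ... | z₁ , x≈ | z₂ , u≈ = from-witness (z₁ * v + y * z₂ + π * (z₁ * z₂)) (begin
      x * u                          ≈⟨ *-cong x≈ u≈ ⟩
      (y + π * z₁) * (v + π * z₂)    ≈⟨ solve 5 (λ y v π z₁ z₂ → (y :+ π :* z₁) :* (v :+ π :* z₂) := y :* v :+ π :* (z₁ :* v :+ y :* z₂ :+ π :* (z₁ :* z₂))) refl y v π z₁ z₂ ⟩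
      y * v + π * (z₁ * v + y * z₂ + π * (z₁ * z₂)) ∎)

    -‿cong-mod : ∀ {x y} → x ≡ y [mod π ] → (- x) ≡ - y [mod π ]
    -‿cong-mod {x} {y} x≡y = mod-trans (≈⇒≡ (sym (-1*x≈-x x)))
                               (mod-trans (*-cong-mod mod-refl x≡y) (≈⇒≡ (-1*x≈-x y)))

    mod-setoid : Setoid c (c ⊔ ℓ)
    mod-setoid = record
      { Carrier = Carrier
      ; _≈_ = _≡_[mod π ]
      ; isEquivalence = record { refl = mod-refl ; sym = mod-sym ; trans = mod-trans }
      }

  record Ideal z : Set (c ⊔ ℓ ⊔ lsuc z) where
    field
      Member      : Carrier → Set z
      Member-resp : ∀ {x y} → x ≈ y → Member x → Member y
      0∈          : Member 0#
      +∈          : ∀ {x y} → Member x → Member y → Member (x + y)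
      *∈          : ∀ x {y} → Member y → Member (x * y)

    -∈ : ∀ {x} → Member x → Member (- x)
    -∈ {x} x∈ = Member-resp (-1*x≈-x x) (*∈ (- 1#) x∈)

  zero-ideal : Ideal ℓ
  zero-ideal = record
    { Member      = _≈ 0#
    ; Member-resp = λ x≈y x≈0 → trans (sym x≈y) x≈0
    ; 0∈          = refl
    ; +∈          = λ x≈0 y≈0 → trans (+-cong x≈0 y≈0) (+-identityʳ 0#)
    ; *∈          = λ x y≈0 → trans (*-congˡ y≈0) (zeroʳ x)
    }

  mod-ideal : Carrier → Ideal (c ⊔ ℓ)
  mod-ideal π = record
    { Member      = _≡ 0# [mod π ]
    ; Member-resp = λ x≈y x≡0 → mod-trans (≈⇒≡ (sym x≈y)) x≡0
    ; 0∈          = mod-refl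
    ; +∈          = λ x≡0 y≡0 → mod-trans (+-cong-mod x≡0 y≡0) (≈⇒≡ (+-identityʳ 0#))
    ; *∈          = λ x y≡0 → mod-trans (*-cong-mod mod-refl y≡0) (≈⇒≡ (zeroʳ x))
    }
    where open Congruence π

  -- Power series whose coefficients lie in an ideal I above a given degree,
  -- i.e. polynomials modulo I together with a degree bound; such bounds are
  -- preserved by the ring operations on power series.
  module Vanishing {z} (I : Ideal z) where
    open Ideal I

    VanishesAbove : ℕ → Poly → Set z
    VanishesAbove d f = ∀ n → d < n → Member (f n)

    weaken : ∀ {d d′ f} → d ≤ d′ → VanishesAbove d f → VanishesAbove d′ f
    weaken d≤d′ f-vanishes n d′<n = f-vanishes n (ℕₚ.≤-<-trans d≤d′ d′<n)

    mono-vanishes : ∀ a k → VanishesAbove k (mono a k)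
    mono-vanishes a k n k<n with k ≡ᵇ n | ℕₚ.≡ᵇ⇒≡ k n
    ... | true  | k≡n = ⊥-elim (ℕₚ.<⇒≢ k<n (k≡n tt))
    ... | false | _   = 0∈

    ⊕-vanishes : ∀ {d f g} → VanishesAbove d f → VanishesAbove d g → VanishesAbove d (f ⊕ g)
    ⊕-vanishes f-vanishes g-vanishes n d<n = +∈ (f-vanishes n d<n) (g-vanishes n d<n)

    ⊖-vanishes : ∀ {d f g} → VanishesAbove d f → VanishesAbove d g → VanishesAbove d (f ⊖ g)
    ⊖-vanishes f-vanishes g-vanishes n d<n = +∈ (f-vanishes n d<n) (-∈ (g-vanishes n d<n))

    ·-vanishes : ∀ {d f} a → VanishesAbove d f → VanishesAbove d (a · f)
    ·-vanishes a f-vanishes n d<n = *∈ a (f-vanishes n d<n)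

    sum∈ : ∀ n g → (∀ i → i ≤ n → Member (g i)) → Member (sumUpTo n g)
    sum∈ zero    g g∈ = g∈ 0 z≤n
    sum∈ (suc n) g g∈ = +∈ (sum∈ n g (λ i i≤n → g∈ i (ℕₚ.m≤n⇒m≤1+n i≤n))) (g∈ (suc n) ℕₚ.≤-refl)

    -- Degrees add under the Cauchy product: in f i · g (n - i) with n > d₁ + d₂,
    -- either i > d₁ or n - i > d₂.
    ⊗-vanishes : ∀ {d₁ d₂ f g} → VanishesAbove d₁ f → VanishesAbove d₂ g →
                 VanishesAbove (d₁ ℕ.+ d₂) (f ⊗ g)
    ⊗-vanishes {d₁} {d₂} {f} {g} f-vanishes g-vanishes n d₁+d₂<n =
      sum∈ n (λ i → f i * g (n ℕ.∸ i)) term∈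
      where
      term∈ : ∀ i → i ≤ n → Member (f i * g (n ℕ.∸ i))
      term∈ i _ with i ℕ.≤? d₁
      ... | no  i≰d₁ = Member-resp (*-comm _ _) (*∈ (g (n ℕ.∸ i)) (f-vanishes i (ℕₚ.≰⇒> i≰d₁)))
      ... | yes i≤d₁ = *∈ (f i) (g-vanishes (n ℕ.∸ i) (complement-index i≤d₁ d₁+d₂<n))

    powP-vanishes : ∀ {d f} k → VanishesAbove d f → VanishesAbove (k ℕ.* d) (powP f k)
    powP-vanishes zero    f-vanishes = mono-vanishes 1# 0
    powP-vanishes (suc k) f-vanishes = ⊗-vanishes f-vanishes (powP-vanishes k f-vanishes)

  -- In a p-torsion-free ring, if a positive integer j kills X then X ≡ 0 mod p.
  -- For j prime to p this is a Bézout identity; otherwise j = q p, and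
  -- torsion freeness lets us pass from j to the smaller q.
  module TorsionFreeCancellation {p} (p-prime : Prime p) (torsion-free : TorsionFree p) where
    open Congruence (ι p)
    open import Algebra.Properties.Group +-group using (inverseˡ-unique)

    coprime-cancel : ∀ {j} X → ¬ p ∣ j → ι j * X ≈ 0# → X ≡ 0# [mod ι p ]
    coprime-cancel {j} X p∤j jX≈0 with coprime-Bézout (prime-coprime p-prime p∤j)
    ... | Bézout.+- l k 1+kj≡lp = divisible⇒≡0 (ι l * X) (begin
      X                        ≈⟨ +-identityʳ X ⟨
      X + 0#                   ≈⟨ +-congˡ (trans (*-congˡ jX≈0) (zeroʳ (ι k))) ⟨
      X + ι k * (ι j * X)      ≈⟨ ι-1+* k j X ⟨
      ι (suc (k ℕ.* j)) * X    ≈⟨ *-congʳ (ι-cong 1+kj≡lp) ⟩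
      ι (l ℕ.* p) * X          ≈⟨ *-congʳ (ι-* l p) ⟩
      ι l * ι p * X            ≈⟨ solve 3 (λ l p X → l :* p :* X := p :* (l :* X)) refl (ι l) (ι p) X ⟩
      ι p * (ι l * X)          ∎)
    ... | Bézout.-+ l k 1+lp≡kj = divisible⇒≡0 (- (ι l * X)) (begin
      X                        ≈⟨ inverseˡ-unique X (ι l * (ι p * X)) X+lpX≈0 ⟩
      - (ι l * (ι p * X))      ≈⟨ -‿cong (solve 3 (λ l p X → l :* (p :* X) := p :* (l :* X)) refl (ι l) (ι p) X) ⟩
      - (ι p * (ι l * X))      ≈⟨ -‿distribʳ-* (ι p) (ι l * X) ⟩
      ι p * - (ι l * X)        ∎)
      where
      X+lpX≈0 : X + ι l * (ι p * X) ≈ 0#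
      X+lpX≈0 = begin
        X + ι l * (ι p * X)    ≈⟨ ι-1+* l p X ⟨
        ι (suc (l ℕ.* p)) * X  ≈⟨ *-congʳ (ι-cong 1+lp≡kj) ⟩
        ι (k ℕ.* j) * X        ≈⟨ *-congʳ (ι-* k j) ⟩
        ι k * ι j * X          ≈⟨ *-assoc (ι k) (ι j) X ⟩
        ι k * (ι j * X)        ≈⟨ *-congˡ jX≈0 ⟩
        ι k * 0#               ≈⟨ zeroʳ (ι k) ⟩
        0#                     ∎

    cancel : ∀ j X → 0 < j → ι j * X ≈ 0# → X ≡ 0# [mod ι p ]
    cancel j = cancel-acc j (<-wellFounded j)
      where
      1<p : 1 < p
      1<p = ℕ.nonTrivial⇒n>1 p {{prime⇒nonTrivial p-prime}}

      cancel-acc : ∀ j → Acc _<_ j → ∀ X → 0 < j → ι j * X ≈ 0# → X ≡ 0# [mod ι p ]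
      cancel-acc j (acc smaller) X 0<j jX≈0 with p ∣? j
      ... | no  p∤j = coprime-cancel X p∤j jX≈0
      ... | yes (divides q j≡qp) with cofactor-smaller 1<p 0<j j≡qp
      ...   | 0<q , q<j = cancel-acc q (smaller q<j) X 0<q (torsion-free (ι q * X) (begin
        ι p * (ι q * X)        ≈⟨ solve 3 (λ p q X → p :* (q :* X) := q :* p :* X) refl (ι p) (ι q) X ⟩
        ι q * ι p * X          ≈⟨ *-congʳ (ι-* q p) ⟨
        ι (q ℕ.* p) * X        ≈⟨ *-congʳ (ι-cong j≡qp) ⟨
        ι j * X                ≈⟨ jX≈0 ⟩
        0#                     ∎))

module Recurrence {c ℓ} (R : CommutativeRing c ℓ) (p : ℕ)
                  (a b θ λ0 half δa δb : CommutativeRing.Carrier R)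
                  (K0 W0 : WithRing.Poly R) where
  open CommutativeRing R
  open WithRing R
  open RingFacts R
  open Setup p a b θ λ0 half δa δb K0 W0 public
  open Congruence (ι p)
  module Exact = Vanishing zero-ideal
  module ModP = Vanishing (mod-ideal (ι p))

  lhs rhs : (ℕ → Carrier) → ℕ → Carrier
  lhs u s = ι s * b ^ p * u s
  rhs u s = (ι 3 * half − ι s) * a ^ p * back 1 u s + (ι 9 * half − ι s) * back 3 u s
            + cc s + dd s + ee s + ff s

  SourcesVanish : ℕ → Set (c ⊔ ℓ)
  SourcesVanish s = (cc s ≡ 0# [mod ι p ]) × (dd s ≡ 0# [mod ι p ]) ×
                    (ee s ≡ 0# [mod ι p ]) × (ff s ≡ 0# [mod ι p ])

  back-cong : ∀ k s {u u′} → (∀ t → t ≤ s → u t ≡ u′ t [mod ι p ]) →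
              back k u s ≡ back k u′ s [mod ι p ]
  back-cong k s u≡u′ with k ≤ᵇ s
  ... | true  = u≡u′ (s ℕ.∸ k) (ℕₚ.m∸n≤m s k)
  ... | false = mod-refl

  Star-resp : ∀ s {u u′} → (∀ t → t ≤ s → u t ≡ u′ t [mod ι p ]) → Star u s → Star u′ s
  Star-resp s {u} {u′} u≡u′ star = begin
    lhs u′ s   ≈⟨ *-cong-mod mod-refl (u≡u′ s ℕₚ.≤-refl) ⟨
    lhs u s    ≈⟨ star ⟩
    rhs u s    ≈⟨ rhs-cong ⟩
    rhs u′ s   ∎
    where
    open import Relation.Binary.Reasoning.Setoid mod-setoid
    rhs-cong : rhs u s ≡ rhs u′ s [mod ι p ]
    rhs-cong = +-cong-mod (+-cong-mod (+-cong-mod (+-cong-mod (+-cong-mod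
                 (*-cong-mod mod-refl (back-cong 1 s u≡u′))
                 (*-cong-mod mod-refl (back-cong 3 s u≡u′))) mod-refl) mod-refl) mod-refl) mod-refl

  cubic-vanishes : ∀ z₄ z₆ → Exact.VanishesAbove 3 (cubic z₄ z₆)
  cubic-vanishes z₄ z₆ = Exact.⊕-vanishes
    (Exact.⊕-vanishes (Exact.mono-vanishes 1# 3) (Exact.weaken (s≤s z≤n) (Exact.mono-vanishes z₄ 1)))
    (Exact.weaken z≤n (Exact.mono-vanishes z₆ 0))

  fHalf-vanishes : Exact.VanishesAbove (3 ℕ.* p) (fHalf p a b)
  fHalf-vanishes = Exact.weaken h*3≤3*p (Exact.powP-vanishes h (cubic-vanishes a b))
    where
    h : ℕ
    h = (p ℕ.∸ 1) / 2
    h*3≤3*p : h ℕ.* 3 ≤ 3 ℕ.* p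
    h*3≤3*p = ℕₚ.≤-trans (ℕₚ.*-monoˡ-≤ 3 (ℕₚ.≤-trans (m/n≤m (p ℕ.∸ 1) 2) (ℕₚ.m∸n≤m p 1)))
                         (ℕₚ.≤-reflexive (ℕₚ.*-comm p 3))

  exact⇒mod : ∀ {d f} → Exact.VanishesAbove d f → ModP.VanishesAbove d f
  exact⇒mod f-vanishes n d<n = ≈⇒≡ (f-vanishes n d<n)

  module SourceBounds (p-prime : Prime p) (torsion-free : TorsionFree p)
                      (isK0 : IsK0 p a b K0) (isW0 : IsW0 p a b λ0 W0) where
    open TorsionFreeCancellation p-prime torsion-free

    -- p K0 is a polynomial of degree ≤ 3p, so K0 is one too, by torsion freeness.
    K0-vanishes : ModP.VanishesAbove (3 ℕ.* p) K0
    K0-vanishes n 3p<n = ≈⇒≡ (torsion-free (K0 n) (trans (isK0 n) (pK0-vanishes n 3p<n)))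
      where
      pK0-vanishes : Exact.VanishesAbove (3 ℕ.* p)
        (mono 1# (3 ℕ.* p) ⊕ mono (a ^ p) p ⊕ mono (b ^ p) 0 ⊖ powP (cubic a b) p)
      pK0-vanishes = Exact.⊖-vanishes
        (Exact.⊕-vanishes (Exact.⊕-vanishes (Exact.mono-vanishes 1# (3 ℕ.* p))
                                            (Exact.weaken (ℕₚ.m≤m+n p _) (Exact.mono-vanishes (a ^ p) p)))
                          (Exact.weaken z≤n (Exact.mono-vanishes (b ^ p) 0)))
        (Exact.weaken (ℕₚ.≤-reflexive (ℕₚ.*-comm p 3)) (Exact.powP-vanishes p (cubic-vanishes a b)))

    -- (n+1) W0_{n+1} = λ0 (f^{(p-1)/2})_n - [n = p-1] vanishes for n > 3p, and
    -- then W0_{n+1} ≡ 0 mod p by cancellation.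
    W0-vanishes : ModP.VanishesAbove (suc (3 ℕ.* p)) W0
    W0-vanishes (suc n) (s≤s 3p<n) =
      cancel (suc n) (W0 (suc n)) (s≤s z≤n) (trans (proj₂ isW0 n) (W0′-vanishes n 3p<n))
      where
      W0′-vanishes : Exact.VanishesAbove (3 ℕ.* p) (λ0 · fHalf p a b ⊖ mono 1# (p ℕ.∸ 1))
      W0′-vanishes = Exact.⊖-vanishes (Exact.·-vanishes λ0 fHalf-vanishes)
        (Exact.weaken (ℕₚ.≤-trans (ℕₚ.m∸n≤m p 1) (ℕₚ.m≤m+n p _)) (Exact.mono-vanishes 1# (p ℕ.∸ 1)))

    -- Modulo p, C, D, E, F are polynomials of degree ≤ 8p + 1; their
    -- coefficients of x^{sp-1} therefore vanish once s ≥ 9.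
    pre-vanishes : ModP.VanishesAbove (3 ℕ.* p) pre
    pre-vanishes = ModP.·-vanishes (λ0 * half) (exact⇒mod fHalf-vanishes)

    T-vanishes : ModP.VanishesAbove (2 ℕ.* p) T
    T-vanishes = ModP.⊕-vanishes (ModP.·-vanishes (ι 3) (ModP.mono-vanishes 1# (2 ℕ.* p)))
                                 (ModP.weaken z≤n (ModP.mono-vanishes (a ^ p) 0))

    degree : ℕ
    degree = 3 ℕ.* p ℕ.+ (2 ℕ.* p ℕ.+ suc (3 ℕ.* p))

    Dp-vanishes : ModP.VanishesAbove degree Dp
    Dp-vanishes = ModP.⊗-vanishes pre-vanishes (ModP.⊕-vanishes
      (ModP.weaken (ℕₚ.≤-trans (ℕₚ.n≤1+n _) (ℕₚ.m≤n+m _ _)) K0-vanishes)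
      (ModP.⊗-vanishes T-vanishes W0-vanishes))

    Cp-vanishes : ModP.VanishesAbove degree Cp
    Cp-vanishes = ModP.weaken
      (ℕₚ.≤-trans (ℕₚ.≤-reflexive (ℕₚ.+-assoc (3 ℕ.* p) (2 ℕ.* p) p))
                  (ℕₚ.+-monoʳ-≤ (3 ℕ.* p) (ℕₚ.+-monoʳ-≤ (2 ℕ.* p) p≤1+3p)))
      (ModP.⊗-vanishes (ModP.⊗-vanishes pre-vanishes T-vanishes) (ModP.mono-vanishes θ p))
      where
      p≤1+3p : p ≤ suc (3 ℕ.* p)
      p≤1+3p = ℕₚ.≤-trans (ℕₚ.m≤m+n p _) (ℕₚ.n≤1+n _)

    Ep-vanishes : ModP.VanishesAbove degree Ep
    Ep-vanishes = ModP.weaken (ℕₚ.+-monoʳ-≤ (3 ℕ.* p) z≤n)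
      (ModP.⊗-vanishes pre-vanishes (ModP.mono-vanishes δb 0))

    Fp-vanishes : ModP.VanishesAbove degree Fp
    Fp-vanishes = ModP.weaken (ℕₚ.+-monoʳ-≤ (3 ℕ.* p) (ℕₚ.≤-trans (ℕₚ.m≤m+n p (1 ℕ.* p)) (ℕₚ.m≤m+n (2 ℕ.* p) _)))
      (ModP.⊗-vanishes pre-vanishes (ModP.mono-vanishes δa p))

    sources-vanish : 3 ≤ p → ∀ s → 9 ≤ s → SourcesVanish s
    sources-vanish 3≤p s 9≤s =
      Cp-vanishes _ large , Dp-vanishes _ large , Ep-vanishes _ large , Fp-vanishes _ large
      where
      large : degree < s ℕ.* p ℕ.∸ 1
      large = below-sp-1 3≤p 9≤s

  module Truncation (half-inv : ι 2 * half ≈ 1#) (N : ℕ) (centre : (3 ℕ.+ N) ℕ.* 2 ≡ p ℕ.+ 9)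
                    (sources : ∀ s → 3 ℕ.+ N ≤ s → SourcesVanish s)
                    (v : ℕ → Carrier)
                    (star-low : ∀ s → 1 ≤ s → s ≤ 2 ℕ.+ N → Star v s)
                    (v[N+1]≡0 : v (suc N) ≡ 0# [mod ι p ])
                    (v[N+2]≡0 : v (2 ℕ.+ N) ≡ 0# [mod ι p ]) where
    open Ideal (mod-ideal (ι p))

    w : ℕ → Carrier
    w = truncate N v

    truncate-low : ∀ {t} → t ≤ N → w t ≡ v t
    truncate-low {t} t≤N with t ≤ᵇ N | ℕₚ.≤⇒≤ᵇ t≤N
    ... | true | _ = Eq.refl

    truncate-high : ∀ {t} → N < t → w t ≡ 0#
    truncate-high {t} N<t with t ≤ᵇ N | ℕₚ.≤ᵇ⇒≤ t N
    ... | true  | t≤N = ⊥-elim (ℕₚ.<⇒≱ N<t (t≤N tt))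
    ... | false | _   = Eq.refl

    w-high : ∀ {t} → N < t → w t ≡ 0# [mod ι p ]
    w-high N<t = ≈⇒≡ (reflexive (truncate-high N<t))

    agrees : ∀ t → t ≤ 2 ℕ.+ N → v t ≡ w t [mod ι p ]
    agrees t t≤2+N with t ℕ.≤? N
    ... | yes t≤N = ≈⇒≡ (reflexive (Eq.sym (truncate-low t≤N)))
    ... | no  t≰N = mod-trans (v[t]≡0 (just-above N<t t≤2+N)) (mod-sym (w-high N<t))
      where
      N<t : N < t
      N<t = ℕₚ.≰⇒> t≰N
      v[t]≡0 : t ≡ suc N ⊎ t ≡ 2 ℕ.+ N → v t ≡ 0# [mod ι p ]
      v[t]≡0 (inj₁ Eq.refl) = v[N+1]≡0
      v[t]≡0 (inj₂ Eq.refl) = v[N+2]≡0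

    star-w-low : ∀ s → 1 ≤ s → s ≤ 2 ℕ.+ N → Star w s
    star-w-low s 1≤s s≤2+N =
      Star-resp s (λ t t≤s → agrees t (ℕₚ.≤-trans t≤s s≤2+N)) (star-low s 1≤s s≤2+N)

    back-high : ∀ k s → k ℕ.+ N < s → back k w s ≡ 0# [mod ι p ]
    back-high k s k+N<s with k ≤ᵇ s
    ... | true  = w-high (shifted-above k+N<s)
    ... | false = mod-refl

    -- At s = N + 3 = (p+9)/2 the coefficient 9/2 - s is -p/2 ≡ 0.
    centre-coefficient : (ι 9 * half − ι (3 ℕ.+ N)) ≡ 0# [mod ι p ]
    centre-coefficient = mod-trans (+-cong-mod mod-refl (-‿cong-mod s≡9/2))
                                   (≈⇒≡ (-‿inverseʳ (ι 9 * half)))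
      where
      s≡9/2 : ι (3 ℕ.+ N) ≡ ι 9 * half [mod ι p ]
      s≡9/2 = from-witness half (begin
        ι (3 ℕ.+ N)                    ≈⟨ *-identityʳ _ ⟨
        ι (3 ℕ.+ N) * 1#               ≈⟨ *-congˡ half-inv ⟨
        ι (3 ℕ.+ N) * (ι 2 * half)     ≈⟨ *-assoc _ _ _ ⟨
        ι (3 ℕ.+ N) * ι 2 * half       ≈⟨ *-congʳ (ι-* (3 ℕ.+ N) 2) ⟨
        ι ((3 ℕ.+ N) ℕ.* 2) * half     ≈⟨ *-congʳ (ι-cong centre) ⟩
        ι (p ℕ.+ 9) * half             ≈⟨ *-congʳ (ι-+ p 9) ⟩
        (ι p + ι 9) * half             ≈⟨ distribʳ half (ι p) (ι 9) ⟩
        ι p * half + ι 9 * half        ≈⟨ +-comm _ _ ⟩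
        ι 9 * half + ι p * half        ∎)
        where open import Relation.Binary.Reasoning.Setoid setoid

    -- The term (9/2 - s) w_{s-3} vanishes for s ≥ N + 3: at s = N + 3 by the
    -- coefficient, beyond it because w_{s-3} = 0.
    back3-term : ∀ s → 3 ℕ.+ N ≤ s → ((ι 9 * half − ι s) * back 3 w s) ≡ 0# [mod ι p ]
    back3-term s N+3≤s with s ℕ.≟ 3 ℕ.+ N
    ... | yes Eq.refl = Member-resp (*-comm _ _) (*∈ (back 3 w s) centre-coefficient)
    ... | no  s≢N+3   = *∈ _ (back-high 3 s (ℕₚ.≤∧≢⇒< N+3≤s (λ e → s≢N+3 (Eq.sym e))))

    star-w-high : ∀ s → 3 ℕ.+ N ≤ s → Star w s
    star-w-high s N+3≤s with sources s N+3≤s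
    ... | c≡0 , d≡0 , e≡0 , f≡0 = mod-trans lhs≡0 (mod-sym rhs≡0)
      where
      lhs≡0 : lhs w s ≡ 0# [mod ι p ]
      lhs≡0 = *∈ (ι s * b ^ p) (w-high (ℕₚ.≤-trans (ℕₚ.m≤n+m (suc N) 2) N+3≤s))
      rhs≡0 : rhs w s ≡ 0# [mod ι p ]
      rhs≡0 = +∈ (+∈ (+∈ (+∈ (+∈ (*∈ _ (back-high 1 s (ℕₚ.≤-trans (ℕₚ.n≤1+n (2 ℕ.+ N)) N+3≤s)))
                                  (back3-term s N+3≤s)) c≡0) d≡0) e≡0) f≡0

    truncation : ∀ s → 1 ≤ s → Star w s
    truncation s 1≤s with s ℕ.≤? 2 ℕ.+ N
    ... | yes s≤N+2 = star-w-low s 1≤s s≤N+2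
    ... | no  s≰N+2 = star-w-high s (ℕₚ.≰⇒> s≰N+2)

-- Proposition 4.2.  With p = 2m + 1 and N = (p+3)/2 = m + 2, we have
-- (p+5)/2 = N + 1, (p+7)/2 = N + 2 and (p+9)/2 = N + 3 ≥ 9, so the
-- truncation argument applies with the degree bounds for the sources.
proposition4p2 : ∀ {c ℓ} (R : CommutativeRing c ℓ) (p : ℕ) → Prime p → 11 ≤ p →
    let open CommutativeRing R
        open WithRing R
    in (φ : Carrier → Carrier) →
       TorsionFree p → PAdicComplete p → IsFrobeniusLift p φ →
       (a b θ : Carrier) →
       IsUnit (Δ a b) → IsUnit b →
       (λ0 : Carrier) → λ0 * H p a b ≈ 1# →
       (half : Carrier) → ι 2 * half ≈ 1# →
       (δa δb : Carrier) → ι p * δa ≈ φ a − a ^ p → ι p * δb ≈ φ b − b ^ p →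
       (K0 W0 : Poly) → IsK0 p a b K0 → IsW0 p a b λ0 W0 →
       (v : ℕ → Carrier) →
       (∀ s → 1 ≤ s → s ≤ bound7 p → Setup.Star p a b θ λ0 half δa δb K0 W0 v s) →
       v (bound5 p) ≡ 0# [mod ι p ] →
       v (bound7 p) ≡ 0# [mod ι p ] →
       ∀ s → 1 ≤ s → Setup.Star p a b θ λ0 half δa δb K0 W0 (truncate (bound3 p) v) s
proposition4p2 R p p-prime 11≤p _ torsion-free _ _ a b θ _ _ λ0 _ half half-inv δa δb _ _
               K0 W0 isK0 isW0 v star-low v[p+5/2]≡0 v[p+7/2]≡0
  with odd-prime p-prime (ℕₚ.≤-trans (ℕₚ.m≤m+n 3 8) 11≤p)
... | m , Eq.refl =
  subst (λ N → ∀ s → 1 ≤ s → Star (truncate N v) s) (Eq.sym (half-of-odd-sum m 1)) truncation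
  where
  open CommutativeRing R
  open WithRing R
  open Recurrence R p a b θ λ0 half δa δb K0 W0
  open SourceBounds p-prime torsion-free isK0 isW0
  3≤p : 3 ≤ p
  3≤p = ℕₚ.≤-trans (ℕₚ.m≤m+n 3 8) 11≤p
  open Truncation half-inv (2 ℕ.+ m) (centre-index m)
    (λ s N+3≤s → sources-vanish 3≤p s (ℕₚ.≤-trans (centre-large m 11≤p) N+3≤s)) v
    (λ s 1≤s s≤N+2 → star-low s 1≤s (subst (s ≤_) (Eq.sym (half-of-odd-sum m 3)) s≤N+2))
    (subst (λ t → v t ≡ 0# [mod ι p ]) (half-of-odd-sum m 2) v[p+5/2]≡0)
    (subst (λ t → v t ≡ 0# [mod ι p ]) (half-of-odd-sum m 3) v[p+7/2]≡0)
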